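{- If $\langle A,\rightarrow,\rightarrow,\top\rangle$ is a Semi-BCI algebra (both operations equal to the same $\rightarrow$), then $\langle A,\rightarrow,\top\rangle$ is a BCI-algebra.
   Context: A BCI-algebra is a structure $\langle A,\rightarrow,\top\rangle$ such that for all $x,y,z\in A$: (C1) $(y\rightarrow z)\rightarrow((z\rightarrow x)\rightarrow(y\rightarrow x))=\top$; (C2) $x\rightarrow((x\rightarrow y)\rightarrow y)=\top$; (C3) $x\rightarrow x=\top$; (C4) $x\rightarrow y=\top$ and $y\rightarrow x=\top$ imply $x=y$. A Semi-BCI (SBCI) algebra is a structure $\langle A,\twoheadrightarrow,\rightarrow,\top\rangle$ with two binary operations and $\top\in A$, where $x\ll y$ iff $x\twoheadrightarrow y=\top$ and $x\preceq y$ iff $x\rightarrow y=\top$, such that for all $x,y,z$: (S1) $x\twoheadrightarrow(y\twoheadrightarrow z)=y\twoheadrightarrow(x\twoheadrightarrow z)$; (S2) $x\rightarrow(y\rightarrow z)=y\rightarrow(x\rightarrow z)$; (S3) $x\twoheadrightarrow y\preceq(z\twoheadrightarrow x)\rightarrow(z\twoheadrightarrow y)$; (S4) $\top\twoheadrightarrow x=x$; (S5) if $x\ll y\preceq z$ then $x\ll z$; (S6) if $x\preceq y\ll z$ then $x\ll z$; (S7) if $x\preceq y$ and $y\preceq x$ then $x=y$. -}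

module Defs where

open import Level using (Level; suc; _⊔_)
open import Relation.Binary.PropositionalEquality using (_≡_)

record IsBCI {a : Level} (A : Set a) (_⇒_ : A → A → A) (⊤ : A) : Set a where
  field
    C1 : ∀ x y z → (y ⇒ z) ⇒ ((z ⇒ x) ⇒ (y ⇒ x)) ≡ ⊤
    C2 : ∀ x y → x ⇒ ((x ⇒ y) ⇒ y) ≡ ⊤
    C3 : ∀ x → x ⇒ x ≡ ⊤
    C4 : ∀ x y → x ⇒ y ≡ ⊤ → y ⇒ x ≡ ⊤ → x ≡ y

record IsSBCI {a : Level} (A : Set a) (_↠_ : A → A → A) (_⇒_ : A → A → A) (⊤ : A) : Set a where
  _≪_ : A → A → Set a
  x ≪ y = x ↠ y ≡ ⊤
  _≼_ : A → A → Set a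
  x ≼ y = x ⇒ y ≡ ⊤
  field
    S1 : ∀ x y z → x ↠ (y ↠ z) ≡ y ↠ (x ↠ z)
    S2 : ∀ x y z → x ⇒ (y ⇒ z) ≡ y ⇒ (x ⇒ z)
    S3 : ∀ x y z → (x ↠ y) ≼ ((z ↠ x) ⇒ (z ↠ y))
    S4 : ∀ x → ⊤ ↠ x ≡ x
    S5 : ∀ x y z → x ≪ y → y ≼ z → x ≪ z
    S6 : ∀ x y z → x ≼ y → y ≪ z → x ≪ z
    S7 : ∀ x y → x ≼ y → y ≼ x → x ≡ y

module Submission where

-- Instantiating (S3) at z = ⊤ and simplifying with (S4) shows that in
-- every Semi-BCI algebra  x ↠ y ≼ x ⇒ y.  When ↠ and ⇒ are the same
-- operation this says that every implication  x ⇒ y  is ≼-reflexive, and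
-- since ⊤ ⇒ x = x, every element is.  The BCI axioms then follow:
--   (C1) is (S3) read through the exchange law (S2),
--   (C2) is reflexivity of  x ⇒ y  read through (S2),
--   (C3) is reflexivity,
--   (C4) is antisymmetry (S7).

open import Level using (Level)
open import Defs
open import Relation.Binary.PropositionalEquality using (_≡_; subst₂; trans)

module SBCIProperties {a : Level} {A : Set a} {_↠_ _⇒_ : A → A → A} {⊤ : A}
                      (S : IsSBCI A _↠_ _⇒_ ⊤) where
  open IsSBCI S

  -- (S3) with z = ⊤ reads  x ↠ y ≼ (⊤ ↠ x) ⇒ (⊤ ↠ y),  and ⊤ ↠ _ is the identity.
  ↠-below-⇒ : ∀ x y → (x ↠ y) ≼ (x ⇒ y)
  ↠-below-⇒ x y =
    subst₂ (λ u v → (x ↠ y) ⇒ (u ⇒ v) ≡ ⊤) (S4 x) (S4 y) (S3 x y ⊤)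

module CollapsedSBCI {a : Level} {A : Set a} {_⇒_ : A → A → A} {⊤ : A}
                     (S : IsSBCI A _⇒_ _⇒_ ⊤) where
  open IsSBCI S
  open SBCIProperties S using (↠-below-⇒)

  ⇒-refl : ∀ x y → (x ⇒ y) ≼ (x ⇒ y)
  ⇒-refl = ↠-below-⇒

  ≼-refl : ∀ x → x ≼ x
  ≼-refl x = subst₂ _≼_ (S4 x) (S4 x) (⇒-refl ⊤ x)

  suffixing : ∀ x y z → (y ⇒ z) ≼ ((z ⇒ x) ⇒ (y ⇒ x))
  suffixing x y z = trans (S2 (y ⇒ z) (z ⇒ x) (y ⇒ x)) (S3 z x y)

  modus-ponens : ∀ x y → x ≼ ((x ⇒ y) ⇒ y)
  modus-ponens x y = trans (S2 x (x ⇒ y) y) (⇒-refl x y)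

proposition11 : {a : Level} (A : Set a) (_⇒_ : A → A → A) (⊤ : A)
    → IsSBCI A _⇒_ _⇒_ ⊤ → IsBCI A _⇒_ ⊤
proposition11 A _⇒_ ⊤ S = record
  { C1 = suffixing
  ; C2 = modus-ponens
  ; C3 = ≼-refl
  ; C4 = IsSBCI.S7 S
  }
  where open CollapsedSBCI S
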